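{- Let $n\ge 2$ and let $T$ be a rooted tree on the vertex set $\{1,\dots,n\}$ with slither code $(s_1,\dots,s_{n-1})$. Let $\alpha$ be the smallest number such that $(s_1,\dots,s_\alpha)$ contains at least $n-\alpha$ distinct numbers. Suppose that $(s_1,\dots,s_{\alpha-1})$ already contains $n-\alpha$ distinct numbers and that $s_\alpha$ does not occur in $(s_1,\dots,s_{\alpha-1})$, so that $(s_1,\dots,s_\alpha)$ contains $n-\alpha+1$ distinct numbers. Then $s_\alpha$ is the root of $T$ and the root is a $P$-position. Moreover, the $\alpha$ vertices not occurring in $(s_1,\dots,s_{\alpha-1})$ are exactly the $P$-positions, and they constitute a maximum independent set of $T$.
   Context: Edges of $T$ are directed away from the root. A vertex is a $P$-position iff none of its children is a $P$-position (leaves are $P$-positions); otherwise it is an $N$-position. Slither code: start with $n-1$ empty slots; repeat $n-1$ times: among non-root vertices of the current tree with no remaining children, remove the one with smallest label and put its label into the leftmost empty slot if it is a $P$-position of the original tree $T$, otherwise into the rightmost empty slot. This gives $(a_1,\dots,a_{n-1})$; then $s_i$ is the parent of $a_i$ in $T$. -}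

module Defs where

open import Data.Nat using (ℕ; zero; suc; _∸_; _≤_)
open import Data.Bool using (Bool; true; false; not; _∧_; _∨_)
open import Data.Fin using (Fin; _≟_)
open import Data.Fin.Subset using (Subset; _∈_; ∣_∣)
open import Data.List using (List; []; _∷_; _++_; allFin; filterᵇ; map; reverse; deduplicate; length; take)
open import Data.Bool.ListAction using (any; all)
open import Data.Maybe using (Maybe; just; nothing)
open import Data.Vec using (tabulate)
open import Data.Product using (∃; _×_)
open import Relation.Nullary using (¬_)
open import Relation.Nullary.Decidable using (⌊_⌋)
open import Relation.Binary.PropositionalEquality using (_≡_; _≢_)

iter : {A : Set} → (A → A) → ℕ → A → A
iter f zero x = x
iter f (suc k) x = f (iter f k x)

-- A rooted tree on the vertex set Fin n (vertex i stands for label i+1;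
-- the order of labels is the order of Fin n).  Edges are parent w → w for
-- every non-root w; by convention parent root ≡ root.
record RootedTree (n : ℕ) : Set where
  field
    root    : Fin n
    parent  : Fin n → Fin n
    parent-root : parent root ≡ root
    reaches : ∀ v → ∃ λ k → iter parent k v ≡ root

module _ {n : ℕ} (T : RootedTree n) where
  open RootedTree T

  isChild : Fin n → Fin n → Bool
  isChild w v = not ⌊ w ≟ root ⌋ ∧ ⌊ parent w ≟ v ⌋

  Edge : Fin n → Fin n → Set
  Edge v w = (w ≢ root) × (parent w ≡ v)

  -- P-position computed with fuel; correct once fuel ≥ height of v,
  -- and height ≤ n - 1 < n, so fuel n is always enough.
  -- A vertex is P iff none of its children is P (leaves are P).
  isPFuel : ℕ → Fin n → Bool
  isPFuel zero v = true
  isPFuel (suc k) v = not (any (λ w → isChild w v ∧ isPFuel k w) (allFin n))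

  isP : Fin n → Bool
  isP = isPFuel n

  Pset : Subset n
  Pset = tabulate isP

  memB : Fin n → List (Fin n) → Bool
  memB v = any (λ u → ⌊ u ≟ v ⌋)

  isCurrentLeaf : List (Fin n) → Fin n → Bool
  isCurrentLeaf removed v =
    not ⌊ v ≟ root ⌋ ∧ not (memB v removed)
    ∧ all (λ w → not (isChild w v) ∨ memB w removed) (allFin n)

  firstB : {A : Set} → (A → Bool) → List A → Maybe A
  firstB p [] = nothing
  firstB p (x ∷ xs) with p x
  ... | true = just x
  ... | false = firstB p xs

  removalFrom : ℕ → List (Fin n) → List (Fin n)
  removalFrom zero removed = []
  removalFrom (suc k) removed with firstB (isCurrentLeaf removed) (allFin n)
  ... | nothing = []
  ... | just v = v ∷ removalFrom k (v ∷ removed)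

  removalOrder : List (Fin n)
  removalOrder = removalFrom (n ∸ 1) []

  -- (a_1,…,a_{n-1}): P-positions fill the slots from the left in removal
  -- order, N-positions fill from the right in removal order.
  slitherA : List (Fin n)
  slitherA = filterᵇ isP removalOrder ++ reverse (filterᵇ (λ v → not (isP v)) removalOrder)

  slither : List (Fin n)
  slither = map parent slitherA

  Independent : Subset n → Set
  Independent S = ∀ v w → v ∈ S → w ∈ S → ¬ Edge v w

  MaximumIndependent : Subset n → Set
  MaximumIndependent S = Independent S × (∀ I → Independent I → ∣ I ∣ ≤ ∣ S ∣)

distinct : {n : ℕ} → List (Fin n) → ℕ
distinct xs = length (deduplicate _≟_ xs)

-- 1-indexed lookup
at : {A : Set} → List A → ℕ → Maybe A
at [] _ = nothing
at (x ∷ xs) zero = nothing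
at (x ∷ xs) (suc zero) = just x
at (x ∷ xs) (suc (suc k)) = at xs (suc k)

-- Let codeP list the parents of the non-root P-positions in removal order and codeN the
-- parents of the N-positions in reverse removal order, so that the slither code is codeP ++ codeN.
-- The parent of a P-position is an N-position and every N-position has a P-child, so the entries
-- of codeP are exactly the N-positions. Hence no prefix of codeP has more than n − |P| distinct
-- entries while codeP itself has exactly n − |P|; minimality then forces the root to be a
-- P-position (otherwise |codeP| = |P| would already qualify as α) and α = |codeP| + 1 = |P|. So
-- s_α is the parent of the last N-position removed, and that parent can only be the root.
-- Finally, mapping each vertex of an independent set to itself or to one of its P-children is
-- injective, so no independent set is larger than the set of P-positions.

module Submission where

module ListProperties where

  open import Data.Bool using (Bool; true; false; not; _∧_; _∨_; T?)
  open import Data.Bool.ListAction using (any; all)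
  open import Data.Bool.Properties using (T-≡)
  open import Data.Empty using (⊥-elim)
  open import Data.Fin using (Fin; zero; suc)
  open import Data.Fin.Subset using (Subset; ∣_∣)
  open import Data.List using (List; []; _∷_; _++_; _∷ʳ_; map; length; filterᵇ; take; reverse)
    renaming (tabulate to tabulateˡ)
  open import Data.List.Membership.Propositional using (_∈_; _∉_)
  open import Data.List.Membership.Propositional.Properties using (∈-∃++; ∈-++⁺ʳ; ∈-filter⁺; ∈-filter⁻)
  open import Data.List.Properties using (length-++; ∷-injective; ∷-injectiveʳ; reverse-involutive; unfold-reverse)
  open import Data.List.Relation.Binary.Subset.Propositional using (_⊆_)
  open import Data.List.Relation.Unary.All as All using (All; []; _∷_)
  open import Data.List.Relation.Unary.All.Properties using (map⁺)
  open import Data.List.Relation.Unary.Any using (here; there)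
  open import Data.List.Relation.Unary.Unique.Propositional using (Unique; []; _∷_)
  open import Data.Maybe using (just; nothing)
  open import Data.Nat using (zero; suc; _+_; _≤_; s≤s; z≤n)
  open import Data.Nat.Properties using (≤-trans; ≤-reflexive; +-suc)
  open import Data.Product using (∃; ∃₂; _×_; _,_; map₂)
  open import Data.Vec using ([]; _∷_; lookup)
  open import Function using (_∘_; Equivalence)
  open import Relation.Binary.PropositionalEquality using (_≡_; _≢_; refl; sym; trans; cong; cong₂)

  open import Defs using (at)

  module _ {A : Set} where

    ∈-++-∷⁻ : ∀ {x y : A} xs ys → y ∈ xs ++ x ∷ ys → y ≢ x → y ∈ xs ++ ys
    ∈-++-∷⁻ []       ys (here y≡x)  y≢x = ⊥-elim (y≢x y≡x)
    ∈-++-∷⁻ []       ys (there y∈)  y≢x = y∈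
    ∈-++-∷⁻ (_ ∷ xs) ys (here y≡z)  y≢x = here y≡z
    ∈-++-∷⁻ (_ ∷ xs) ys (there y∈)  y≢x = there (∈-++-∷⁻ xs ys y∈ y≢x)

    Unique-⊆⇒length≤ : ∀ {xs ys : List A} → Unique xs → xs ⊆ ys → length xs ≤ length ys
    Unique-⊆⇒length≤ {[]}     _          _   = z≤n
    Unique-⊆⇒length≤ {x ∷ xs} (x≢xs ∷ u) sub with ∈-∃++ (sub (here refl))
    ... | as , bs , refl = ≤-trans (s≤s ih) (≤-reflexive (sym length-as++x∷bs))
      where
      ih : length xs ≤ length (as ++ bs)
      ih = Unique-⊆⇒length≤ u λ y∈ → ∈-++-∷⁻ as bs (sub (there y∈)) λ y≡x → All.lookup x≢xs y∈ (sym y≡x)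
      length-as++x∷bs : length (as ++ x ∷ bs) ≡ suc (length (as ++ bs))
      length-as++x∷bs = trans (length-++ as) (trans (+-suc (length as) (length bs)) (cong suc (sym (length-++ as))))

    Unique-++⇒disjoint : ∀ {x : A} xs ys → Unique (xs ++ ys) → x ∈ xs → x ∉ ys
    Unique-++⇒disjoint (_ ∷ xs) ys (x≢ ∷ _) (here refl) x∈ys = All.lookup x≢ (∈-++⁺ʳ xs x∈ys) refl
    Unique-++⇒disjoint (_ ∷ xs) ys (_ ∷ u)  (there x∈) x∈ys = Unique-++⇒disjoint xs ys u x∈ x∈ys

    Unique-map⁺ : ∀ {B : Set} (f : A → B) {xs} → (∀ {x y} → x ∈ xs → y ∈ xs → f x ≡ f y → x ≡ y) →
                  Unique xs → Unique (map f xs)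
    Unique-map⁺ f inj [] = []
    Unique-map⁺ f inj (x≢xs ∷ u) =
      map⁺ (All.tabulate λ y∈ fx≡fy → All.lookup x≢xs y∈ (inj (here refl) (there y∈) fx≡fy))
      ∷ Unique-map⁺ f (λ x∈ y∈ → inj (there x∈) (there y∈)) u

    any-true⁻ : ∀ (p : A → Bool) xs → any p xs ≡ true → ∃ λ x → x ∈ xs × p x ≡ true
    any-true⁻ p (x ∷ xs) eq with p x in px
    ... | true  = x , here refl , px
    ... | false with any-true⁻ p xs eq
    ...   | y , y∈ , py = y , there y∈ , py

    any-true⁺ : ∀ (p : A → Bool) {x} xs → x ∈ xs → p x ≡ true → any p xs ≡ true
    any-true⁺ p (x ∷ xs) (here refl) px rewrite px = refl
    any-true⁺ p (y ∷ xs) (there x∈) px with p y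
    ... | true  = refl
    ... | false = any-true⁺ p xs x∈ px

    all-true⁻ : ∀ (p : A → Bool) {x} xs → all p xs ≡ true → x ∈ xs → p x ≡ true
    all-true⁻ p (y ∷ xs) eq x∈ with p y in py
    all-true⁻ p (y ∷ xs) eq (here refl) | true = py
    all-true⁻ p (y ∷ xs) eq (there x∈)  | true = all-true⁻ p xs eq x∈

    all-false⁻ : ∀ (p : A → Bool) xs → all p xs ≡ false → ∃ λ x → x ∈ xs × p x ≡ false
    all-false⁻ p (x ∷ xs) eq with p x in px
    ... | false = x , here refl , px
    ... | true with all-false⁻ p xs eq
    ...   | y , y∈ , py = y , there y∈ , py

    any-cong : ∀ (p q : A → Bool) xs → (∀ {x} → x ∈ xs → p x ≡ q x) → any p xs ≡ any q xs
    any-cong p q []       _   = refl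
    any-cong p q (x ∷ xs) p≗q = cong₂ _∨_ (p≗q (here refl)) (any-cong p q xs (p≗q ∘ there))

    ∈-filterᵇ⁺ : ∀ (p : A → Bool) {x xs} → x ∈ xs → p x ≡ true → x ∈ filterᵇ p xs
    ∈-filterᵇ⁺ p x∈ px = ∈-filter⁺ (T? ∘ p) x∈ (Equivalence.from T-≡ px)

    ∈-filterᵇ⁻ : ∀ (p : A → Bool) {x xs} → x ∈ filterᵇ p xs → x ∈ xs × p x ≡ true
    ∈-filterᵇ⁻ p x∈ = map₂ (Equivalence.to T-≡) (∈-filter⁻ (T? ∘ p) x∈)

    length-filterᵇ-partition : ∀ (p : A → Bool) xs →
      length (filterᵇ p xs) + length (filterᵇ (not ∘ p) xs) ≡ length xs
    length-filterᵇ-partition p []       = refl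
    length-filterᵇ-partition p (x ∷ xs) with p x
    ... | true  = cong suc (length-filterᵇ-partition p xs)
    ... | false = trans (+-suc _ _) (cong suc (length-filterᵇ-partition p xs))

    filterᵇ≡[]⁻ : ∀ (p : A → Bool) xs → filterᵇ p xs ≡ [] → All (λ y → p y ≡ false) xs
    filterᵇ≡[]⁻ p []       _  = []
    filterᵇ≡[]⁻ p (x ∷ xs) eq with p x in px
    ... | false = px ∷ filterᵇ≡[]⁻ p xs eq

    filterᵇ≡∷ʳ⁻ : ∀ (p : A → Bool) xs ys {a} → filterᵇ p xs ≡ ys ∷ʳ a →
      ∃₂ λ pre post → xs ≡ pre ++ a ∷ post × All (λ y → p y ≡ false) post
    filterᵇ≡∷ʳ⁻ p []       []      ()
    filterᵇ≡∷ʳ⁻ p []       (_ ∷ _) ()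
    filterᵇ≡∷ʳ⁻ p (x ∷ xs) ys eq with p x
    filterᵇ≡∷ʳ⁻ p (x ∷ xs) [] eq | true with ∷-injective eq
    ... | refl , rest≡[] = [] , xs , refl , filterᵇ≡[]⁻ p xs rest≡[]
    filterᵇ≡∷ʳ⁻ p (x ∷ xs) (_ ∷ ys) eq | true with filterᵇ≡∷ʳ⁻ p xs ys (∷-injectiveʳ eq)
    ... | pre , post , refl , post-false = x ∷ pre , post , refl , post-false
    filterᵇ≡∷ʳ⁻ p (x ∷ xs) ys eq | false with filterᵇ≡∷ʳ⁻ p xs ys eq
    ... | pre , post , refl , post-false = x ∷ pre , post , refl , post-false

    reverse≡∷⁻ : ∀ xs {a : A} {rest} → reverse xs ≡ a ∷ rest → xs ≡ reverse rest ∷ʳ a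
    reverse≡∷⁻ xs {a} {rest} rev = trans (sym (reverse-involutive xs)) (trans (cong reverse rev) (unfold-reverse a rest))

    take-++-⊆ : ∀ k (xs ys : List A) → k ≤ length xs → take k (xs ++ ys) ⊆ xs
    take-++-⊆ (suc k) (x ∷ xs) ys _         (here y≡x) = here y≡x
    take-++-⊆ (suc k) (x ∷ xs) ys (s≤s k≤) (there y∈) = there (take-++-⊆ k xs ys k≤ y∈)

    ⊆-take-++ : ∀ k (xs ys : List A) → length xs ≤ k → xs ⊆ take k (xs ++ ys)
    ⊆-take-++ (suc k) (x ∷ xs) ys _         (here y≡x) = here y≡x
    ⊆-take-++ (suc k) (x ∷ xs) ys (s≤s ≤k) (there y∈) = there (⊆-take-++ k xs ys ≤k y∈)

    take-length-++ : ∀ (xs ys : List A) → take (length xs) (xs ++ ys) ≡ xs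
    take-length-++ []       ys = refl
    take-length-++ (x ∷ xs) ys = cong (x ∷_) (take-length-++ xs ys)

    at-zero : ∀ (xs : List A) → at xs 0 ≡ nothing
    at-zero []      = refl
    at-zero (_ ∷ _) = refl

    at-++-∈ˡ : ∀ k (xs ys : List A) {y} → k ≤ length xs → at (xs ++ ys) k ≡ just y → y ∈ xs
    at-++-∈ˡ zero          xs       ys _         eq with () ← trans (sym (at-zero (xs ++ ys))) eq
    at-++-∈ˡ (suc zero)    (x ∷ xs) ys _         refl = here refl
    at-++-∈ˡ (suc (suc k)) (x ∷ xs) ys (s≤s k≤) eq   = there (at-++-∈ˡ (suc k) xs ys k≤ eq)

    at-++-suc-length : ∀ (xs ys : List A) → at (xs ++ ys) (suc (length xs)) ≡ at ys 1
    at-++-suc-length []           ys = refl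
    at-++-suc-length (x ∷ [])     ys = refl
    at-++-suc-length (x ∷ y ∷ xs) ys = at-++-suc-length (y ∷ xs) ys

    length-filterᵇ-tabulate : ∀ {k} (S : Subset k) (f : Fin k → A) (p : A → Bool) →
      (∀ i → p (f i) ≡ lookup S i) → length (filterᵇ p (tabulateˡ f)) ≡ ∣ S ∣
    length-filterᵇ-tabulate []       f p p∘f≗S = refl
    length-filterᵇ-tabulate (b ∷ S) f p p∘f≗S with p (f zero) | p∘f≗S zero
    ... | true  | refl = cong suc (length-filterᵇ-tabulate S (f ∘ suc) p (p∘f≗S ∘ suc))
    ... | false | refl = length-filterᵇ-tabulate S (f ∘ suc) p (p∘f≗S ∘ suc)

  ∧≡true⁻ : ∀ {a b} → a ∧ b ≡ true → a ≡ true × b ≡ true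
  ∧≡true⁻ {true} {true} _ = refl , refl

  not-∨≡false⁻ : ∀ {a b} → (not a ∨ b) ≡ false → a ≡ true × b ≡ false
  not-∨≡false⁻ {true} {false} _ = refl , refl

  not≡true⁻ : ∀ {b} → not b ≡ true → b ≡ false
  not≡true⁻ {false} _ = refl

  not≡false⁻ : ∀ {b} → not b ≡ false → b ≡ true
  not≡false⁻ {true} _ = refl


module TreeProperties where

  open import Data.Bool using (Bool; true; false; not; _∧_; _∨_; T?)
  open import Data.Bool.ListAction using (any; all)
  open import Data.Bool.Properties using (T-≡)
  open import Data.Empty using (⊥; ⊥-elim)
  open import Data.Fin using (Fin; toℕ) renaming (_≟_ to _≟ᶠ_)
  open import Data.Fin.Properties using (pigeonhole; toℕ<n)
  open import Data.Fin.Subset using (∣_∣) renaming (_∈_ to _∈ₛ_)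
  open import Data.List using (List; []; _∷_; _++_; allFin; filterᵇ; map; length)
  open import Data.List.Membership.Propositional using (_∈_; _∉_)
  open import Data.List.Membership.Propositional.Properties using (∈-allFin; ∈-map⁻)
  open import Data.List.Properties using (length-map; length-tabulate; ∷-injective)
  open import Data.List.Relation.Binary.Permutation.Propositional using (↭-sym)
  open import Data.List.Relation.Binary.Permutation.Propositional.Properties using (∈-resp-↭; shift)
  open import Data.List.Relation.Binary.Subset.Propositional using (_⊆_)
  open import Data.List.Relation.Unary.All as All using (All; []; _∷_)
  open import Data.List.Relation.Unary.Any using (here; there; any?)
  open import Data.List.Relation.Unary.Unique.Propositional using (Unique; []; _∷_)
  open import Data.List.Relation.Unary.Unique.Propositional.Properties using (filter⁺; allFin⁺)
  open import Data.Maybe using (just; nothing)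
  open import Data.Nat using (ℕ; zero; suc; _+_; _*_; _≤_; _<_; z≤n; s≤s; _<?_)
  open import Data.Nat.Properties
    using (≤-trans; ≤-reflexive; ≤-pred; n≤1+n; +-suc; +-identityʳ; *-suc; +-comm; <-irrefl; <⇒≱; ≮⇒≥; <-≤-trans; module ≤-Reasoning)
  open import Data.Product using (∃; _×_; _,_; proj₁; proj₂)
  open import Data.Sum using (_⊎_; inj₁; inj₂)
  open import Data.Vec using (lookup)
  open import Data.Vec.Properties using (lookup∘tabulate; []=⇒lookup; lookup⇒[]=)
  open import Function using (id; _∘_; Equivalence)
  open import Relation.Binary.PropositionalEquality
    using (_≡_; _≢_; refl; sym; trans; cong; cong₂; subst; module ≡-Reasoning)
  open import Relation.Nullary using (yes; no; contradiction)
  open import Relation.Nullary.Decidable using (⌊_⌋; toWitness; fromWitness)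

  open import Defs
  open ListProperties

  iter-suc : ∀ {A : Set} (f : A → A) k x → iter f (suc k) x ≡ iter f k (f x)
  iter-suc f zero    x = refl
  iter-suc f (suc k) x = cong f (iter-suc f k x)

  iter-+ : ∀ {A : Set} (f : A → A) j k x → iter f (j + k) x ≡ iter f j (iter f k x)
  iter-+ f zero    k x = refl
  iter-+ f (suc j) k x = cong f (iter-+ f j k x)

  iter-fixed : ∀ {A : Set} (f : A → A) {x} → f x ≡ x → ∀ k → iter f k x ≡ x
  iter-fixed f fx≡x zero    = refl
  iter-fixed f fx≡x (suc k) = trans (cong f (iter-fixed f fx≡x k)) fx≡x

  iter-periodic : ∀ {A : Set} (f : A → A) {x} k → iter f k x ≡ x → ∀ t → iter f (t * k) x ≡ x
  iter-periodic f k period zero    = refl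
  iter-periodic f k period (suc t) =
    trans (iter-+ f k (t * k) _) (trans (cong (iter f k) (iter-periodic f k period t)) period)

  module _ {m : ℕ} (T : RootedTree (suc m)) where
    open RootedTree T

    private
      n = suc m

    -- A vertex on a cycle reaches the root, which is a fixed point, in a multiple of the cycle length.
    parent-cycle⇒root : ∀ k v → iter parent (suc k) v ≡ v → v ≡ root
    parent-cycle⇒root k v cycle = begin
        v                                      ≡⟨ sym (iter-periodic parent (suc k) cycle d) ⟩
        iter parent (d * suc k) v              ≡⟨ cong (λ j → iter parent j v) (trans (*-suc d k) (+-comm d (d * k))) ⟩
        iter parent (d * k + d) v              ≡⟨ iter-+ parent (d * k) d v ⟩
        iter parent (d * k) (iter parent d v)  ≡⟨ cong (iter parent (d * k)) v↦root ⟩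
        iter parent (d * k) root               ≡⟨ iter-fixed parent parent-root (d * k) ⟩
        root ∎
      where
      open ≡-Reasoning
      d : ℕ
      d = proj₁ (reaches v)
      v↦root : iter parent d v ≡ root
      v↦root = proj₂ (reaches v)

    isChild⇒Edge : ∀ {w v} → isChild T w v ≡ true → Edge T v w
    isChild⇒Edge {w} {v} eq with w ≟ᶠ root | parent w ≟ᶠ v
    ... | no w≢root | yes pw≡v = w≢root , pw≡v
    ... | yes _     | _        with () ← eq
    ... | no _      | no _     with () ← eq

    Edge⇒isChild : ∀ {v w} → Edge T v w → isChild T w v ≡ true
    Edge⇒isChild {v} {w} (w≢root , pw≡v) with w ≟ᶠ root | parent w ≟ᶠ v
    ... | no _       | yes _    = refl
    ... | yes w≡root | _        = ⊥-elim (w≢root w≡root)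
    ... | no _       | no pw≢v  = ⊥-elim (pw≢v pw≡v)

    HeightBelow : ℕ → Fin n → Set
    HeightBelow zero    v = ⊥
    HeightBelow (suc k) v = ∀ w → Edge T v w → HeightBelow k w

    AncestorsDistinct : ℕ → Fin n → Set
    AncestorsDistinct d v = ∀ {i j} → i < j → j ≤ d → iter parent i v ≢ iter parent j v

    ancestorsDistinct⇒< : ∀ {d v} → AncestorsDistinct d v → d < n
    ancestorsDistinct⇒< {d} {v} distinct with d <? n
    ... | yes d<n = d<n
    ... | no d≮n with i , j , i<j , same ← pigeonhole (s≤s (≮⇒≥ d≮n)) (λ i → iter parent (toℕ i) v)
      = ⊥-elim (distinct i<j (≤-pred (toℕ<n j)) same)

    ancestorsDistinct-child : ∀ {d v w} → Edge T v w → AncestorsDistinct d v → AncestorsDistinct (suc d) w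
    ancestorsDistinct-child {w = w} (w≢root , refl) distinct {zero}  {suc j} _          _          w≡ =
      w≢root (parent-cycle⇒root j w (sym w≡))
    ancestorsDistinct-child {w = w} (w≢root , refl) distinct {suc i} {suc j} (s≤s i<j) (s≤s j≤d) eq =
      distinct i<j j≤d (trans (sym (iter-suc parent i w)) (trans eq (iter-suc parent j w)))

    -- The d + 1 distinct vertices v, parent v, … together with a chain of k edges below v
    -- are k + d + 1 distinct vertices.
    heightBelow : ∀ k d v → AncestorsDistinct d v → n ≤ k + d → HeightBelow k v
    heightBelow zero    d v distinct n≤d = <-irrefl refl (<-≤-trans (ancestorsDistinct⇒< distinct) n≤d)
    heightBelow (suc k) d v distinct n≤ w edge =
      heightBelow k (suc d) w (ancestorsDistinct-child edge distinct) (subst (n ≤_) (sym (+-suc k d)) n≤)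

    heightBelow-n : ∀ v → HeightBelow n v
    heightBelow-n v = heightBelow n 0 v nothing-above (≤-reflexive (sym (+-identityʳ n)))
      where
      nothing-above : AncestorsDistinct 0 v
      nothing-above () z≤n

    isPFuel-stable : ∀ {k v} → HeightBelow k v → ∀ t → k ≤ t → isPFuel T t v ≡ isPFuel T k v
    isPFuel-stable {suc k} {v} below (suc t) (s≤s k≤t) = cong not (any-cong _ _ (allFin n) same)
      where
      same : ∀ {w} → w ∈ allFin n → (isChild T w v ∧ isPFuel T t w) ≡ (isChild T w v ∧ isPFuel T k w)
      same {w} _ with isChild T w v in child
      ... | false = refl
      ... | true  = isPFuel-stable (below w (isChild⇒Edge child)) t k≤t

    isP-unfold : ∀ v → isP T v ≡ not (any (λ w → isChild T w v ∧ isP T w) (allFin n))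
    isP-unfold v = cong not (any-cong _ _ (allFin n) same)
      where
      same : ∀ {w} → w ∈ allFin n → (isChild T w v ∧ isPFuel T m w) ≡ (isChild T w v ∧ isP T w)
      same {w} _ with isChild T w v in child
      ... | false = refl
      ... | true  = sym (isPFuel-stable (heightBelow-n v w (isChild⇒Edge child)) n (n≤1+n m))

    P⇒child-N : ∀ {v w} → Edge T v w → isP T v ≡ true → isP T w ≡ false
    P⇒child-N {v} {w} edge vP with isP T w in wP
    ... | false = refl
    ... | true = contradiction (trans (sym vP) (trans (isP-unfold v) (cong not some-P-child))) λ ()
      where
      some-P-child : any (λ u → isChild T u v ∧ isP T u) (allFin n) ≡ true
      some-P-child = any-true⁺ (λ u → isChild T u v ∧ isP T u) (allFin n) (∈-allFin w)
                               (cong₂ _∧_ (Edge⇒isChild edge) wP)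

    N⇒P-child : ∀ {v} → isP T v ≡ false → ∃ λ w → Edge T v w × isP T w ≡ true
    N⇒P-child {v} vN with any (λ w → isChild T w v ∧ isP T w) (allFin n) in some
    ... | true with w , _ , child∧P ← any-true⁻ _ (allFin n) some
      = w , isChild⇒Edge (proj₁ (∧≡true⁻ child∧P)) , proj₂ (∧≡true⁻ child∧P)
    ... | false with () ← trans (sym vN) (trans (isP-unfold v) (cong not some))

    P⇒parent-N : ∀ {w} → w ≢ root → isP T w ≡ true → isP T (parent w) ≡ false
    P⇒parent-N {w} w≢root wP with isP T (parent w) in pP
    ... | false = refl
    ... | true with () ← trans (sym wP) (P⇒child-N (w≢root , refl) pP)

    ∈Pset⁺ : ∀ {v} → isP T v ≡ true → v ∈ₛ Pset T
    ∈Pset⁺ {v} vP = lookup⇒[]= v (Pset T) (trans (lookup∘tabulate (isP T) v) vP)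

    ∈Pset⁻ : ∀ {v} → v ∈ₛ Pset T → isP T v ≡ true
    ∈Pset⁻ {v} v∈ = trans (sym (lookup∘tabulate (isP T) v)) ([]=⇒lookup v∈)

    Pset-independent : Independent T (Pset T)
    Pset-independent v w v∈ w∈ edge = contradiction (trans (sym (∈Pset⁻ w∈)) (P⇒child-N edge (∈Pset⁻ v∈))) λ ()

    Ps : List (Fin n)
    Ps = filterᵇ (isP T) (allFin n)

    ∣Pset∣≡length-Ps : ∣ Pset T ∣ ≡ length Ps
    ∣Pset∣≡length-Ps = sym (length-filterᵇ-tabulate (Pset T) id (isP T) λ v → sym (lookup∘tabulate (isP T) v))

    P-representative : ∀ v → ∃ λ u → isP T u ≡ true × (u ≡ v ⊎ Edge T v u)
    P-representative v with isP T v in vP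
    ... | true  = v , vP , inj₁ refl
    ... | false with w , edge , wP ← N⇒P-child vP = w , wP , inj₂ edge

    Pset-maximum : ∀ I → Independent T I → ∣ I ∣ ≤ ∣ Pset T ∣
    Pset-maximum I independent = begin
        ∣ I ∣                  ≡⟨ sym (length-filterᵇ-tabulate I id (lookup I) λ _ → refl) ⟩
        length Is              ≡⟨ sym (length-map rep Is) ⟩
        length (map rep Is)    ≤⟨ Unique-⊆⇒length≤ (Unique-map⁺ rep rep-injective (filter⁺ (T? ∘ lookup I) (allFin⁺ n))) rep∈Ps ⟩
        length Ps              ≡⟨ sym ∣Pset∣≡length-Ps ⟩
        ∣ Pset T ∣             ∎
      where
      open ≤-Reasoning
      Is : List (Fin n)
      Is = filterᵇ (lookup I) (allFin n)
      rep : Fin n → Fin n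
      rep v = proj₁ (P-representative v)
      covers : ∀ v → rep v ≡ v ⊎ Edge T v (rep v)
      covers v = proj₂ (proj₂ (P-representative v))

      ∈I : ∀ {v} → v ∈ Is → v ∈ₛ I
      ∈I {v} v∈ = lookup⇒[]= v I (proj₂ (∈-filterᵇ⁻ (lookup I) v∈))

      rep∈Ps : map rep Is ⊆ Ps
      rep∈Ps u∈ with v , _ , refl ← ∈-map⁻ rep u∈ = ∈-filterᵇ⁺ (isP T) (∈-allFin (rep v)) (proj₁ (proj₂ (P-representative v)))

      same-representative : ∀ {x y u} → x ∈ₛ I → y ∈ₛ I → u ≡ x ⊎ Edge T x u → u ≡ y ⊎ Edge T y u → x ≡ y
      same-representative x∈ y∈ (inj₁ refl)       (inj₁ refl)       = refl
      same-representative x∈ y∈ (inj₁ refl)       (inj₂ edge)       = ⊥-elim (independent _ _ y∈ x∈ edge)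
      same-representative x∈ y∈ (inj₂ edge)       (inj₁ refl)       = ⊥-elim (independent _ _ x∈ y∈ edge)
      same-representative x∈ y∈ (inj₂ (_ , refl)) (inj₂ (_ , refl)) = refl

      rep-injective : ∀ {x y} → x ∈ Is → y ∈ Is → rep x ≡ rep y → x ≡ y
      rep-injective {x} {y} x∈ y∈ eq =
        same-representative (∈I x∈) (∈I y∈) (covers x) (subst (λ u → u ≡ y ⊎ Edge T y u) (sym eq) (covers y))

    memB-true⁻ : ∀ {v R} → memB T v R ≡ true → v ∈ R
    memB-true⁻ {v} {R} eq with u , u∈ , u≟v ← any-true⁻ (λ u → ⌊ u ≟ᶠ v ⌋) R eq =
      subst (_∈ R) (toWitness (Equivalence.from T-≡ u≟v)) u∈

    memB-false⁻ : ∀ {v R} → memB T v R ≡ false → v ∉ R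
    memB-false⁻ {v} {R} eq v∈ =
      contradiction (trans (sym eq) (any-true⁺ (λ u → ⌊ u ≟ᶠ v ⌋) R v∈ (Equivalence.to T-≡ (fromWitness refl)))) λ ()

    CurrentLeaf : List (Fin n) → Fin n → Set
    CurrentLeaf R v = v ≢ root × v ∉ R × (∀ w → Edge T v w → w ∈ R)

    isCurrentLeaf⁻ : ∀ {R v} → isCurrentLeaf T R v ≡ true → CurrentLeaf R v
    isCurrentLeaf⁻ {R} {v} eq with v ≟ᶠ root | memB T v R in v∈R
    ... | yes _      | _     with () ← eq
    ... | no _       | true  with () ← eq
    ... | no v≢root  | false = v≢root , memB-false⁻ v∈R , λ w edge → memB-true⁻ (removed w edge)
      where
      removed : ∀ w → Edge T v w → memB T w R ≡ true
      removed w edge = subst (λ b → (not b ∨ memB T w R) ≡ true) (Edge⇒isChild edge)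
                             (all-true⁻ (λ u → not (isChild T u v) ∨ memB T u R) (allFin n) eq (∈-allFin w))

    currentLeaf-exists : ∀ {k R v} → HeightBelow k v → v ≢ root → v ∉ R → ∃ λ u → isCurrentLeaf T R u ≡ true
    currentLeaf-exists {suc k} {R} {v} below v≢root v∉R
      with all (λ w → not (isChild T w v) ∨ memB T w R) (allFin n) in children
    ... | true = v , leaf
      where
      leaf : isCurrentLeaf T R v ≡ true
      leaf with v ≟ᶠ root | memB T v R in v∈R
      ... | yes v≡root | _     = ⊥-elim (v≢root v≡root)
      ... | no _       | true  = ⊥-elim (v∉R (memB-true⁻ v∈R))
      ... | no _       | false = children
    ... | false with w , _ , pending ← all-false⁻ _ (allFin n) children
      with child , w∉R ← not-∨≡false⁻ pending
      = currentLeaf-exists (below w edge) (proj₁ edge) (memB-false⁻ {w} {R} w∉R)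
      where
      edge : Edge T v w
      edge = isChild⇒Edge child

    firstB-just⁻ : ∀ (p : Fin n → Bool) xs {v} → firstB T p xs ≡ just v → p v ≡ true
    firstB-just⁻ p (x ∷ xs) eq with p x in px
    firstB-just⁻ p (x ∷ xs) refl | true  = px
    ...                          | false = firstB-just⁻ p xs eq

    firstB-nothing⁻ : ∀ (p : Fin n → Bool) xs {v} → firstB T p xs ≡ nothing → v ∈ xs → p v ≡ false
    firstB-nothing⁻ p (x ∷ xs) eq v∈ with p x in px
    firstB-nothing⁻ p (x ∷ xs) () v∈          | true
    firstB-nothing⁻ p (x ∷ xs) eq (here refl) | false = px
    firstB-nothing⁻ p (x ∷ xs) eq (there v∈)  | false = firstB-nothing⁻ p xs eq v∈

    nextLeaf : ∀ {R v} → firstB T (isCurrentLeaf T R) (allFin n) ≡ just v → CurrentLeaf R v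
    nextLeaf {R} next = isCurrentLeaf⁻ (firstB-just⁻ (isCurrentLeaf T R) (allFin n) next)

    removalFrom-fresh : ∀ k R {x} → x ∈ removalFrom T k R → x ≢ root × x ∉ R
    removalFrom-fresh (suc k) R x∈ with firstB T (isCurrentLeaf T R) (allFin n) in next
    removalFrom-fresh (suc k) R (here refl) | just v = proj₁ (nextLeaf {R} next) , proj₁ (proj₂ (nextLeaf {R} next))
    removalFrom-fresh (suc k) R (there x∈)  | just v with x≢root , x∉ ← removalFrom-fresh k (v ∷ R) x∈ =
      x≢root , x∉ ∘ there

    removalFrom-unique : ∀ k R → Unique (removalFrom T k R)
    removalFrom-unique zero    R = []
    removalFrom-unique (suc k) R with firstB T (isCurrentLeaf T R) (allFin n)
    ... | nothing = []
    ... | just v  = All.tabulate (λ { x∈ refl → proj₂ (removalFrom-fresh k (v ∷ R) x∈) (here refl) })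
                    ∷ removalFrom-unique k (v ∷ R)

    private
      unique-∷ : ∀ {R v} → Unique (root ∷ R) → v ≢ root → v ∉ R → Unique (root ∷ v ∷ R)
      unique-∷ {R} (root∉R ∷ unique) v≢root v∉R =
        ((v≢root ∘ sym) ∷ root∉R) ∷ All.tabulate (λ { y∈ refl → v∉R y∈ }) ∷ unique

      fresh-vertex⇒length<m : ∀ {R v} → Unique (root ∷ R) → v ≢ root → v ∉ R → length R < m
      fresh-vertex⇒length<m {R} {v} unique v≢root v∉R = ≤-pred too-many
        where
        too-many : length (root ∷ v ∷ R) ≤ n
        too-many = subst (length (root ∷ v ∷ R) ≤_) (length-tabulate {n = n} id)
                         (Unique-⊆⇒length≤ (unique-∷ unique v≢root v∉R) (λ {x} _ → ∈-allFin x))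

    removalFrom-complete : ∀ k R → Unique (root ∷ R) → m ≤ length R + k →
                           ∀ v → v ≢ root → v ∈ removalFrom T k R ++ R
    removalFrom-complete zero R unique m≤ v v≢root with any? (v ≟ᶠ_) R
    ... | yes v∈R = v∈R
    ... | no v∉R  = ⊥-elim (<⇒≱ (fresh-vertex⇒length<m unique v≢root v∉R) (subst (m ≤_) (+-identityʳ _) m≤))
    removalFrom-complete (suc k) R unique m≤ v v≢root with firstB T (isCurrentLeaf T R) (allFin n) in next
    ... | just w = ∈-resp-↭ (shift w (removalFrom T k (w ∷ R)) R)
      (removalFrom-complete k (w ∷ R) (unique-∷ unique w≢root w∉R) (subst (m ≤_) (+-suc _ k) m≤) v v≢root)
      where
      w≢root : w ≢ root
      w≢root = proj₁ (nextLeaf {R} next)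
      w∉R : w ∉ R
      w∉R = proj₁ (proj₂ (nextLeaf {R} next))
    ... | nothing with any? (v ≟ᶠ_) R
    ...   | yes v∈R = v∈R
    ...   | no v∉R with w , w-leaf ← currentLeaf-exists {R = R} (heightBelow-n v) v≢root v∉R =
      contradiction (trans (sym w-leaf) (firstB-nothing⁻ (isCurrentLeaf T R) (allFin n) next (∈-allFin w))) λ ()

    ChildClosed : List (Fin n) → Set
    ChildClosed R = ∀ {v w} → v ∈ R → Edge T v w → w ∈ R

    removalFrom-prefix-closed : ∀ k R pre post → ChildClosed R → removalFrom T k R ≡ pre ++ post → ChildClosed (pre ++ R)
    removalFrom-prefix-closed k       R []        post closed _  = closed
    removalFrom-prefix-closed zero    R (_ ∷ _)   post closed ()
    removalFrom-prefix-closed (suc k) R (x ∷ pre) post closed eq with firstB T (isCurrentLeaf T R) (allFin n) in next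
    ... | just w with refl , rest ← ∷-injective eq =
      λ v∈ edge → ∈-resp-↭ (shift w pre R) (closed-after (∈-resp-↭ (↭-sym (shift w pre R)) v∈) edge)
      where
      closed-with-w : ChildClosed (w ∷ R)
      closed-with-w (here refl) edge = there (proj₂ (proj₂ (nextLeaf {R} next)) _ edge)
      closed-with-w (there v∈)  edge = there (closed v∈ edge)
      closed-after : ChildClosed (pre ++ w ∷ R)
      closed-after = removalFrom-prefix-closed k (w ∷ R) pre post closed-with-w rest


module SlitherProperties where

  open import Data.Bool using (Bool; true; false; not; T?)
  open import Data.Empty using (⊥-elim)
  open import Data.Fin using (Fin) renaming (_≟_ to _≟ᶠ_)
  open import Data.Fin.Subset using () renaming (_∈_ to _∈ₛ_)
  open import Data.List using (List; []; _∷_; _++_; allFin; filterᵇ; map; length; reverse; take; deduplicate)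
  open import Data.List.Membership.Propositional using (_∈_; _∉_)
  open import Data.List.Membership.Propositional.Properties
    using (∈-allFin; ∈-map⁺; ∈-map⁻; ∈-++⁻; ∈-++⁺ʳ; ∈-deduplicate⁺; ∈-deduplicate⁻)
  open import Data.List.Properties using (length-map; length-tabulate; map-++; ++-identityʳ)
  open import Data.List.Relation.Binary.Subset.Propositional using (_⊆_)
  open import Data.List.Relation.Unary.All as All using ([]; _∷_)
  open import Data.List.Relation.Unary.Any using (here; there)
  open import Data.List.Relation.Unary.Unique.Propositional using (Unique; []; _∷_)
  open import Data.List.Relation.Unary.Unique.Propositional.Properties using (filter⁺; allFin⁺)
  import Data.List.Relation.Unary.Unique.DecPropositional.Properties as UniqueDec
  open import Data.Maybe using (just)
  open import Data.Nat using (ℕ; zero; suc; _∸_; _≤_; _<_; s≤s; _<?_)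
  open import Data.Nat.Properties using (≤-antisym; ≤-refl; ≤-trans; n≤1+n; m+n∸m≡n; <-irrefl; ∸-monoʳ-≤; ≮⇒≥)
  open import Data.Product using (_×_; _,_; proj₁; proj₂)
  open import Data.Sum using (inj₁; inj₂)
  open import Function using (id; _∘_)
  open import Function.Bundles using (_⇔_; mk⇔)
  open import Relation.Binary.PropositionalEquality using (_≡_; _≢_; refl; sym; trans; cong; subst)
  open import Relation.Nullary using (¬_; yes; no; contradiction)

  open import Defs
  open ListProperties
  open TreeProperties

  module _ {m : ℕ} (T : RootedTree (suc m)) where
    open RootedTree T

    private
      n = suc m

    order : List (Fin n)
    order = removalOrder T

    order-unique : Unique order
    order-unique = removalFrom-unique T m []

    order-nonroot : ∀ {v} → v ∈ order → v ≢ root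
    order-nonroot v∈ = proj₁ (removalFrom-fresh T m [] v∈)

    order-complete : ∀ {v} → v ≢ root → v ∈ order
    order-complete {v} v≢root =
      subst (v ∈_) (++-identityʳ order) (removalFrom-complete T m [] ([] ∷ []) ≤-refl v v≢root)

    order-prefix-closed : ∀ pre post → order ≡ pre ++ post → ChildClosed T pre
    order-prefix-closed pre post eq =
      subst (ChildClosed T) (++-identityʳ pre) (removalFrom-prefix-closed T m [] pre post (λ ()) eq)

    notP : Fin n → Bool
    notP v = not (isP T v)

    orderP orderN : List (Fin n)
    orderP = filterᵇ (isP T) order
    orderN = filterᵇ notP order

    codeP codeN : List (Fin n)
    codeP = map parent orderP
    codeN = map parent (reverse orderN)

    slither≡codeP++codeN : slither T ≡ codeP ++ codeN
    slither≡codeP++codeN = map-++ parent orderP (reverse orderN)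

    codeP-N : ∀ {y} → y ∈ codeP → isP T y ≡ false
    codeP-N y∈ with w , w∈ , refl ← ∈-map⁻ parent y∈ with w∈order , wP ← ∈-filterᵇ⁻ (isP T) w∈ =
      P⇒parent-N T (order-nonroot w∈order) wP

    N-codeP : ∀ {y} → isP T y ≡ false → y ∈ codeP
    N-codeP yN with w , (w≢root , refl) , wP ← N⇒P-child T yN =
      ∈-map⁺ parent (∈-filterᵇ⁺ (isP T) (order-complete w≢root) wP)

    #P #codeP : ℕ
    #P = length (Ps T)
    #codeP = length codeP

    #codeP≡length-orderP : #codeP ≡ length orderP
    #codeP≡length-orderP = length-map parent orderP

    orderP⊆Ps : orderP ⊆ Ps T
    orderP⊆Ps {x} x∈ = ∈-filterᵇ⁺ (isP T) (∈-allFin x) (proj₂ (∈-filterᵇ⁻ (isP T) {xs = order} x∈))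

    Ps⊆root∷orderP : Ps T ⊆ root ∷ orderP
    Ps⊆root∷orderP {x} x∈ with x ≟ᶠ root
    ... | yes refl     = here refl
    ... | no x≢root    = there (∈-filterᵇ⁺ (isP T) (order-complete x≢root) (proj₂ (∈-filterᵇ⁻ (isP T) x∈)))

    unique-orderP : Unique orderP
    unique-orderP = filter⁺ (T? ∘ isP T) order-unique

    unique-Ps : Unique (Ps T)
    unique-Ps = filter⁺ (T? ∘ isP T) (allFin⁺ n)

    #codeP≤#P : #codeP ≤ #P
    #codeP≤#P = subst (_≤ #P) (sym #codeP≡length-orderP) (Unique-⊆⇒length≤ unique-orderP orderP⊆Ps)

    root-N⇒#P≤#codeP : isP T root ≡ false → #P ≤ #codeP
    root-N⇒#P≤#codeP rootN = subst (#P ≤_) (sym #codeP≡length-orderP) (Unique-⊆⇒length≤ unique-Ps Ps⊆orderP)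
      where
      Ps⊆orderP : Ps T ⊆ orderP
      Ps⊆orderP x∈ with Ps⊆root∷orderP x∈
      ... | here refl = contradiction (trans (sym rootN) (proj₂ (∈-filterᵇ⁻ (isP T) x∈))) λ ()
      ... | there x∈orderP = x∈orderP

    root-P⇒#P≡1+#codeP : isP T root ≡ true → #P ≡ suc #codeP
    root-P⇒#P≡1+#codeP rootP = subst (λ k → #P ≡ suc k) (sym #codeP≡length-orderP)
      (≤-antisym (Unique-⊆⇒length≤ unique-Ps Ps⊆root∷orderP) (Unique-⊆⇒length≤ unique-root∷orderP root∷orderP⊆Ps))
      where
      unique-root∷orderP : Unique (root ∷ orderP)
      unique-root∷orderP = All.tabulate (λ { x∈ refl → order-nonroot (proj₁ (∈-filterᵇ⁻ (isP T) x∈)) refl }) ∷ unique-orderP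
      root∷orderP⊆Ps : root ∷ orderP ⊆ Ps T
      root∷orderP⊆Ps (here refl) = ∈-filterᵇ⁺ (isP T) (∈-allFin root) rootP
      root∷orderP⊆Ps (there x∈)  = orderP⊆Ps x∈

    Ns : List (Fin n)
    Ns = filterᵇ notP (allFin n)

    length-Ns : length Ns ≡ n ∸ #P
    length-Ns = trans (sym (m+n∸m≡n #P (length Ns)))
      (cong (_∸ #P) (trans (length-filterᵇ-partition (isP T) (allFin n)) (length-tabulate {n = n} id)))

    Unique-N⇒length≤ : ∀ {ys} → Unique ys → (∀ {y} → y ∈ ys → isP T y ≡ false) → length ys ≤ n ∸ #P
    Unique-N⇒length≤ {ys} unique allN = subst (length ys ≤_) length-Ns
      (Unique-⊆⇒length≤ unique λ {y} y∈ → ∈-filterᵇ⁺ notP (∈-allFin y) (cong not (allN y∈)))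

    N⊆⇒≤distinct : ∀ {xs} → (∀ {y} → isP T y ≡ false → y ∈ xs) → n ∸ #P ≤ distinct xs
    N⊆⇒≤distinct {xs} N⊆xs = subst (_≤ distinct xs) length-Ns
      (Unique-⊆⇒length≤ (filter⁺ (T? ∘ notP) (allFin⁺ n))
        λ y∈ → ∈-deduplicate⁺ _≟ᶠ_ (N⊆xs (not≡true⁻ (proj₂ (∈-filterᵇ⁻ notP y∈)))))

    module _ (rootP : isP T root ≡ true) {pre a post} (split : order ≡ pre ++ a ∷ post)
             (postP : ∀ {y} → y ∈ post → isP T y ≡ true) where

      private
        ordered : ∀ {u} → u ≢ root → u ∈ pre ++ a ∷ post
        ordered u≢root = subst (_ ∈_) split (order-complete u≢root)

        not-below-pre : ∀ {u w} → u ∈ pre → Edge T u w → w ∉ a ∷ post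
        not-below-pre u∈ edge = Unique-++⇒disjoint pre (a ∷ post) (subst Unique split order-unique)
                                  (order-prefix-closed pre (a ∷ post) split u∈ edge)

        a≢root : a ≢ root
        a≢root = order-nonroot (subst (a ∈_) (sym split) (∈-++⁺ʳ pre (here refl)))

        grandparent-N : parent a ≢ root → parent a ∈ post → isP T (parent (parent a)) ≡ false
        grandparent-N pa≢root pa∈post = P⇒parent-N T pa≢root (postP pa∈post)

        grandparent≢root : parent a ≢ root → parent a ∈ post → parent (parent a) ≢ root
        grandparent≢root pa≢root pa∈post g≡root =
          contradiction (trans (sym rootP) (trans (cong (isP T) (sym g≡root)) (grandparent-N pa≢root pa∈post))) λ ()

        parent∉post : parent a ≢ root → parent a ∉ post
        parent∉post pa≢root pa∈post with ∈-++⁻ pre (ordered (grandparent≢root pa≢root pa∈post))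
        ... | inj₁ g∈pre         = not-below-pre g∈pre (pa≢root , refl) (there pa∈post)
        ... | inj₂ (here g≡a)    = a≢root (parent-cycle⇒root T 1 a g≡a)
        ... | inj₂ (there g∈post) =
          contradiction (trans (sym (grandparent-N pa≢root pa∈post)) (postP g∈post)) λ ()

      -- The parent of a cannot come earlier (children are removed first), be a itself,
      -- or come later (it would be a P-position whose N-parent has nowhere to go).
      last-N-parent-root : parent a ≡ root
      last-N-parent-root with parent a ≟ᶠ root
      ... | yes pa≡root = pa≡root
      ... | no pa≢root with ∈-++⁻ pre (ordered pa≢root)
      ...   | inj₁ pa∈pre          = ⊥-elim (not-below-pre pa∈pre (a≢root , refl) (here refl))
      ...   | inj₂ (here pa≡a)     = ⊥-elim (a≢root (parent-cycle⇒root T 0 a pa≡a))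
      ...   | inj₂ (there pa∈post) = ⊥-elim (parent∉post pa≢root pa∈post)

    codeN-head-root : isP T root ≡ true → ∀ {x} → at codeN 1 ≡ just x → x ≡ root
    codeN-head-root rootP at≡x with reverse orderN in rev
    codeN-head-root rootP refl | a ∷ rest
      with pre , post , split , post-notN ← filterᵇ≡∷ʳ⁻ notP order (reverse rest) (reverse≡∷⁻ orderN rev)
      = last-N-parent-root rootP split (λ y∈ → not≡false⁻ (All.lookup post-notN y∈))

    take-#codeP≡codeP : take #codeP (slither T) ≡ codeP
    take-#codeP≡codeP rewrite slither≡codeP++codeN = take-length-++ codeP codeN

    at-1+#codeP≡codeN-head : at (slither T) (suc #codeP) ≡ at codeN 1
    at-1+#codeP≡codeN-head rewrite slither≡codeP++codeN = at-++-suc-length codeP codeN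

    N≤distinct-take : ∀ {k} → #codeP ≤ k → n ∸ #P ≤ distinct (take k (slither T))
    N≤distinct-take {k} #codeP≤k rewrite slither≡codeP++codeN = N⊆⇒≤distinct (⊆-take-++ k codeP codeN #codeP≤k ∘ N-codeP)

    fresh-in-codeP : ∀ {k x} → suc k ≤ #codeP → at (slither T) (suc k) ≡ just x → x ∉ take k (slither T) →
                     suc (distinct (take k (slither T))) ≤ n ∸ #P
    fresh-in-codeP {k} {x} k<#codeP at≡x x∉ rewrite slither≡codeP++codeN =
      Unique-N⇒length≤ (All.tabulate x≢ ∷ UniqueDec.deduplicate-! _≟ᶠ_ prefix) allN
      where
      prefix : List (Fin n)
      prefix = take k (codeP ++ codeN)
      x≢ : ∀ {y} → y ∈ deduplicate _≟ᶠ_ prefix → x ≢ y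
      x≢ y∈ refl = x∉ (∈-deduplicate⁻ _≟ᶠ_ prefix y∈)
      allN : ∀ {y} → y ∈ x ∷ deduplicate _≟ᶠ_ prefix → isP T y ≡ false
      allN (here refl) = codeP-N (at-++-∈ˡ (suc k) codeP codeN k<#codeP at≡x)
      allN (there y∈)  = codeP-N (take-++-⊆ k codeP codeN (≤-trans (n≤1+n k) k<#codeP) (∈-deduplicate⁻ _≟ᶠ_ prefix y∈))

    ∉take-#codeP⇔∈Pset : ∀ v → v ∉ take #codeP (slither T) ⇔ v ∈ₛ Pset T
    ∉take-#codeP⇔∈Pset v rewrite take-#codeP≡codeP = mk⇔ to from
      where
      to : v ∉ codeP → v ∈ₛ Pset T
      to v∉ with isP T v in vP
      ... | true  = ∈Pset⁺ T vP
      ... | false = ⊥-elim (v∉ (N-codeP vP))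
      from : v ∈ₛ Pset T → v ∉ codeP
      from v∈ v∈codeP = contradiction (trans (sym (∈Pset⁻ T v∈)) (codeP-N v∈codeP)) λ ()

    minimal-α⇒α≡1+#codeP : ∀ α {x} →
      (∀ β → β < α → ¬ (n ∸ β ≤ distinct (take β (slither T)))) →
      n ∸ α ≤ distinct (take (α ∸ 1) (slither T)) →
      at (slither T) α ≡ just x → x ∉ take (α ∸ 1) (slither T) →
      isP T root ≡ true × #P ≡ suc #codeP × α ≡ suc #codeP
    minimal-α⇒α≡1+#codeP zero    _       _      at≡x _  with () ← trans (sym (at-zero (slither T))) at≡x
    minimal-α⇒α≡1+#codeP (suc a) minimal enough at≡x x∉ with a <? #codeP
    ... | yes a<#codeP = ⊥-elim (<-irrefl refl (≤-trans (fresh-in-codeP a<#codeP at≡x x∉)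
                                   (≤-trans (∸-monoʳ-≤ n (≤-trans a<#codeP #codeP≤#P)) enough)))
    ... | no a≮#codeP with isP T root in rootP
    ...   | false = ⊥-elim (minimal #codeP (s≤s (≮⇒≥ a≮#codeP))
                      (≤-trans (∸-monoʳ-≤ n (root-N⇒#P≤#codeP rootP)) (N≤distinct-take ≤-refl)))
    ...   | true with #codeP <? a
    ...     | yes #codeP<a = ⊥-elim (minimal (suc #codeP) (s≤s #codeP<a)
                               (subst (λ k → n ∸ k ≤ distinct (take (suc #codeP) (slither T)))
                                      (root-P⇒#P≡1+#codeP rootP) (N≤distinct-take (n≤1+n #codeP))))
    ...     | no #codeP≮a  =
      refl , root-P⇒#P≡1+#codeP rootP , cong suc (≤-antisym (≮⇒≥ #codeP≮a) (≮⇒≥ a≮#codeP))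

open import Defs
open import Data.Nat using (ℕ; suc; _≤_; _<_; _∸_)
open import Data.Fin using (Fin)
open import Data.Fin.Subset using (_∈_; ∣_∣)
open import Data.List using (take)
open import Data.List.Membership.Propositional using () renaming (_∉_ to _∉ₗ_)
open import Data.Maybe using (just)
open import Data.Product using (_×_; _,_)
open import Data.Bool using (true)
open import Function.Bundles using (_⇔_)
open import Relation.Nullary using (¬_)
open import Relation.Binary.PropositionalEquality using (_≡_; refl; sym; trans)
open TreeProperties
open SlitherProperties

proposition7 : (n : ℕ) → 2 ≤ n → (T : RootedTree n) →
    (α : ℕ) →
    n ∸ α ≤ distinct (take α (slither T)) →
    (∀ β → β < α → ¬ (n ∸ β ≤ distinct (take β (slither T)))) →
    n ∸ α ≤ distinct (take (α ∸ 1) (slither T)) →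
    (x : Fin n) → at (slither T) α ≡ just x →
    x ∉ₗ take (α ∸ 1) (slither T) →
    (x ≡ RootedTree.root T)
    × (isP T (RootedTree.root T) ≡ true)
    × (∀ v → (v ∉ₗ take (α ∸ 1) (slither T)) ⇔ (v ∈ Pset T))
    × (∣ Pset T ∣ ≡ α)
    × MaximumIndependent T (Pset T)
proposition7 (suc m) _ T α _ minimal enough x at≡x x∉
  with rootP , #P≡1+#codeP , refl ← minimal-α⇒α≡1+#codeP T α minimal enough at≡x x∉ =
    codeN-head-root T rootP (trans (sym (at-1+#codeP≡codeN-head T)) at≡x)
  , rootP
  , ∉take-#codeP⇔∈Pset T
  , trans (∣Pset∣≡length-Ps T) #P≡1+#codeP
  , Pset-independent T
  , Pset-maximum T
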